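{- Let $P$ be a finite permutation matrix of bandwidth $w\ge1$, i.e. $w=\max_i|c_i(P)-i|$ where $c_i(P)$ is the column index of the $1$ in row $i$ of $P$. Then $P$ can be written as a product of fewer than $2w$ permutation matrices each of bandwidth at most $1$ (i.e. each factor $T=(t_{ij})$ satisfies $t_{ij}=0$ whenever $|i-j|>1$).
   Context: A permutation matrix is a square $0$-$1$ matrix with exactly one $1$ in each row and each column. A matrix $M=(m_{ij})$ has bandwidth at most $w$ if $m_{ij}=0$ whenever $|i-j|>w$; the bandwidth of a permutation matrix is the least such $w$. -}

module Defs where

open import Data.Nat using (ℕ; zero; suc; _+_; _*_; _∸_; _≤_; _<_)
open import Data.Fin using (Fin; toℕ; _≟_)
open import Data.Sum using (_⊎_)
open import Relation.Nullary using (yes; no)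
open import Data.Product using (_×_; ∃)
open import Data.List using (List; foldr)
open import Relation.Binary.PropositionalEquality using (_≡_)
open import Relation.Nullary using (¬_)

Matrix : ℕ → Set
Matrix n = Fin n → Fin n → ℕ

∑ : (n : ℕ) → (Fin n → ℕ) → ℕ
∑ zero    f = 0
∑ (suc n) f = f Fin.zero + ∑ n (λ i → f (Fin.suc i))

dist : ℕ → ℕ → ℕ
dist a b = (a ∸ b) + (b ∸ a)

IsZeroOne : {n : ℕ} → Matrix n → Set
IsZeroOne {n} M = ∀ (i j : Fin n) → (M i j ≡ 0) ⊎ (M i j ≡ 1)

ExactlyOneInRow : {n : ℕ} → Matrix n → Fin n → Set
ExactlyOneInRow {n} M i = ∃ λ (j : Fin n) → (M i j ≡ 1) × (∀ (k : Fin n) → M i k ≡ 1 → k ≡ j)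

ExactlyOneInCol : {n : ℕ} → Matrix n → Fin n → Set
ExactlyOneInCol {n} M j = ∃ λ (i : Fin n) → (M i j ≡ 1) × (∀ (k : Fin n) → M k j ≡ 1 → k ≡ i)

IsPermutationMatrix : {n : ℕ} → Matrix n → Set
IsPermutationMatrix {n} M =
  IsZeroOne M × (∀ (i : Fin n) → ExactlyOneInRow M i) × (∀ (j : Fin n) → ExactlyOneInCol M j)

HasBandwidthAtMost : {n : ℕ} → ℕ → Matrix n → Set
HasBandwidthAtMost {n} w M = ∀ (i j : Fin n) → w < dist (toℕ i) (toℕ j) → M i j ≡ 0

HasBandwidth : {n : ℕ} → ℕ → Matrix n → Set
HasBandwidth w M = HasBandwidthAtMost w M × (∀ w' → HasBandwidthAtMost w' M → w ≤ w')

_⊗_ : {n : ℕ} → Matrix n → Matrix n → Matrix n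
_⊗_ {n} A B i j = ∑ n (λ k → A i k * B k j)

identity : {n : ℕ} → Matrix n
identity i j with i ≟ j
... | yes _ = 1
... | no  _ = 0

product : {n : ℕ} → List (Matrix n) → Matrix n
product = foldr _⊗_ identity

-- Read P as a permutation a₀ of [0, n) with |a₀ i − i| ≤ w and sort it by a variant of odd-even
-- transposition sort. A round compares disjoint pairs of adjacent positions and exchanges those that
-- are out of order, so it is a permutation matrix of bandwidth 1, and P is the product of the rounds
-- that sort a₀. The split points s, at which a₀ maps [0, s) onto itself, cut the array into blocks,
-- and every block alternates its comparators with its own phase, fixed by its first position
-- (plain odd-even transposition sort may need 2w rounds). To see that 2w − 1 rounds suffice, fix a
-- threshold k and follow the number z of entries below k among the first j positions: a potential
-- argument shows that z reaches its final value min j k within 2w − 1 rounds, for every j. Then for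
-- every k the first k positions hold exactly the values below k, so the array is sorted.

module Submission where

open import Defs
open import Data.Nat
open import Data.Nat.Properties
open import Data.Nat.Induction using (<-rec)
open import Data.Nat.Tactic.RingSolver using (solve-∀)
open import Data.Parity.Base as ℙ using (0ℙ; 1ℙ; _⁻¹)
import Data.Parity.Properties as ℙ
open import Data.Fin as Fin using (Fin; toℕ; fromℕ<)
import Data.Fin.Properties as Fin
open import Data.List using (List; []; _∷_; _∷ʳ_; map; foldl; length)
open import Data.List.Properties using (length-map; length-++; foldl-∷ʳ)
open import Data.List.Relation.Unary.All using (All; [])
import Data.List.Relation.Unary.All.Properties as All
open import Data.Empty using (⊥)
open import Data.Product using (_×_; _,_; proj₁; proj₂; ∃)
open import Data.Sum using (_⊎_; inj₁; inj₂; fromInj₂; reduce)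
open import Function using (_∘_; _|>_)
open import Level using (0ℓ)
open import Relation.Binary.Definitions using (tri<; tri≈; tri>)
open import Relation.Binary.PropositionalEquality
open import Relation.Nullary using (¬_; Dec; yes; no; contradiction; _×-dec_; ¬?)
open import Relation.Unary using (Pred; Decidable)
open import Relation.Unary.Properties using (∁?)

-- Counting below a threshold

module _ {P : Pred ℕ 0ℓ} (P? : Decidable P) where

  count : ℕ → ℕ
  count zero = zero
  count (suc m) with P? m
  ... | yes _ = suc (count m)
  ... | no  _ = count m

  count-yes : ∀ m → P m → count (suc m) ≡ suc (count m)
  count-yes m pm with P? m
  ... | yes _  = refl
  ... | no ¬pm = contradiction pm ¬pm

  count-no : ∀ m → ¬ P m → count (suc m) ≡ count m
  count-no m ¬pm with P? m
  ... | yes pm = contradiction pm ¬pm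
  ... | no _   = refl

  count-≤ : ∀ m → count m ≤ m
  count-≤ zero = z≤n
  count-≤ (suc m) with P? m
  ... | yes _ = s≤s (count-≤ m)
  ... | no  _ = m≤n⇒m≤1+n (count-≤ m)

  count-suc-≤ : ∀ m → count m ≤ count (suc m)
  count-suc-≤ m with P? m
  ... | yes _ = n≤1+n (count m)
  ... | no  _ = ≤-refl

  count-monoʳ : ∀ {m m'} → m ≤ m' → count m ≤ count m'
  count-monoʳ {m} {zero} z≤n = z≤n
  count-monoʳ {m} {suc m'} m≤1+m' with m≤n⇒m<n∨m≡n m≤1+m'
  ... | inj₂ refl = ≤-refl
  ... | inj₁ (s≤s m≤m') = ≤-trans (count-monoʳ m≤m') (count-suc-≤ m')

  count-all : ∀ m → (∀ i → i < m → P i) → count m ≡ m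
  count-all zero    _   = refl
  count-all (suc m) all with P? m
  ... | yes _  = cong suc (count-all m (λ i i<m → all i (m<n⇒m<1+n i<m)))
  ... | no ¬pm = contradiction (all m ≤-refl) ¬pm

  count-all⁻ : ∀ m → m ≤ count m → ∀ i → i < m → P i
  count-all⁻ (suc m) m≤c i i<1+m with P? m
  ... | no  _ = contradiction (≤-trans m≤c (count-≤ m)) (<-irrefl refl)
  ... | yes pm with m≤n⇒m<n∨m≡n (≤-pred i<1+m)
  ...   | inj₁ i<m  = count-all⁻ m (≤-pred m≤c) i i<m
  ...   | inj₂ refl = pm

  count-none : ∀ {m m'} → m ≤ m' → (∀ i → m ≤ i → i < m' → ¬ P i) → count m' ≡ count m
  count-none {m} {zero} z≤n _ = refl
  count-none {m} {suc m'} m≤1+m' none with m≤n⇒m<n∨m≡n m≤1+m'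
  ... | inj₂ refl = refl
  ... | inj₁ (s≤s m≤m') with P? m'
  ...   | yes pm = contradiction pm (none m' m≤m' ≤-refl)
  ...   | no  _  = count-none m≤m' (λ i m≤i i<m' → none i m≤i (m<n⇒m<1+n i<m'))

  count-none⁻ : ∀ {m m'} → count m' ≤ count m → ∀ i → m ≤ i → i < m' → ¬ P i
  count-none⁻ {m} {suc m'} c≤ i m≤i i<1+m' with P? m'
  ... | yes _ = λ _ → <-irrefl refl (≤-trans c≤ (count-monoʳ (≤-trans m≤i (≤-pred i<1+m'))))
  ... | no ¬pm with m≤n⇒m<n∨m≡n (≤-pred i<1+m')
  ...   | inj₁ i<m' = count-none⁻ c≤ i m≤i i<m'
  ...   | inj₂ refl = ¬pm

count-∁ : ∀ {P : Pred ℕ 0ℓ} (P? : Decidable P) m → count P? m + count (∁? P?) m ≡ m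
count-∁ P? zero = refl
count-∁ P? (suc m) with P? m
... | yes _ = cong suc (count-∁ P? m)
... | no  _ = trans (+-suc (count P? m) _) (cong suc (count-∁ P? m))

count-mono-⊆ : ∀ {P Q : Pred ℕ 0ℓ} (P? : Decidable P) (Q? : Decidable Q) m →
               (∀ i → i < m → P i → Q i) → count P? m ≤ count Q? m
count-mono-⊆ P? Q? zero    _ = z≤n
count-mono-⊆ P? Q? (suc m) P⊆Q with P? m | Q? m
... | yes _  | yes _   = s≤s (count-mono-⊆ P? Q? m (λ i i<m → P⊆Q i (m<n⇒m<1+n i<m)))
... | yes pm | no ¬qm  = contradiction (P⊆Q m ≤-refl pm) ¬qm
... | no  _  | yes _   = m≤n⇒m≤1+n (count-mono-⊆ P? Q? m (λ i i<m → P⊆Q i (m<n⇒m<1+n i<m)))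
... | no  _  | no  _   = count-mono-⊆ P? Q? m (λ i i<m → P⊆Q i (m<n⇒m<1+n i<m))

count-injective-≤ : ∀ {P : Pred ℕ 0ℓ} (P? : Decidable P) m k (f : ℕ → ℕ) →
  (∀ i → i < m → P i → f i < k) →
  (∀ i i' → i < m → i' < m → P i → P i' → f i ≡ f i' → i ≡ i') →
  count P? m ≤ k
count-injective-≤ P? zero k f _ _ = z≤n
count-injective-≤ {P} P? (suc m) k f into inj with P? m
... | no _ = count-injective-≤ P? m k f (λ i i<m → into i (m<n⇒m<1+n i<m))
               (λ i i' i<m i'<m → inj i i' (m<n⇒m<1+n i<m) (m<n⇒m<1+n i'<m))
... | yes pm with into m ≤-refl pm
...   | fm<k@(s≤s {n = k'} _) = s≤s (count-injective-≤ P? m k' g into' inj')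
  where
  -- g moves the value k', which must be dropped from the range, to the value f m that m frees up.
  g : ℕ → ℕ
  g i with f i ≟ k'
  ... | yes _ = f m
  ... | no  _ = f i

  fresh : ∀ i → i < m → P i → f i ≢ f m
  fresh i i<m pi fi≡fm = <-irrefl (inj i m (m<n⇒m<1+n i<m) ≤-refl pi pm fi≡fm) i<m

  into' : ∀ i → i < m → P i → g i < k'
  into' i i<m pi with f i ≟ k'
  ... | yes fi≡k' = ≤∧≢⇒< (≤-pred fm<k) (λ fm≡k' → fresh i i<m pi (trans fi≡k' (sym fm≡k')))
  ... | no  fi≢k' = ≤∧≢⇒< (≤-pred (into i (m<n⇒m<1+n i<m) pi)) fi≢k'

  inj' : ∀ i i' → i < m → i' < m → P i → P i' → g i ≡ g i' → i ≡ i'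
  inj' i i' i<m i'<m pi pi' gi≡gi' with f i ≟ k' | f i' ≟ k'
  ... | yes e | yes e' = inj i i' (m<n⇒m<1+n i<m) (m<n⇒m<1+n i'<m) pi pi' (trans e (sym e'))
  ... | yes _ | no  _  = contradiction (sym gi≡gi') (fresh i' i'<m pi')
  ... | no  _ | yes _  = contradiction gi≡gi' (fresh i i<m pi)
  ... | no  _ | no  _  = inj i i' (m<n⇒m<1+n i<m) (m<n⇒m<1+n i'<m) pi pi' gi≡gi'

module _ {P Q : Pred ℕ 0ℓ} (P? : Decidable P) (Q? : Decidable Q) where
  open ≡-Reasoning

  count-cong-suc : ∀ m → count P? m ≡ count Q? m → (P m → Q m) → (Q m → P m) →
                   count P? (suc m) ≡ count Q? (suc m)
  count-cong-suc m c≡ p⇒q q⇒p with P? m | Q? m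
  ... | yes _  | yes _  = cong suc c≡
  ... | yes pm | no ¬qm = contradiction (p⇒q pm) ¬qm
  ... | no ¬pm | yes qm = contradiction (q⇒p qm) ¬pm
  ... | no _   | no _   = c≡

  count-swap-last-two : ∀ m → count P? m ≡ count Q? m →
                        (P m → Q (suc m)) → (Q (suc m) → P m) →
                        (P (suc m) → Q m) → (Q m → P (suc m)) →
                        count P? (suc (suc m)) ≡ count Q? (suc (suc m))
  count-swap-last-two m c≡ p⇒q q⇒p p'⇒q' q'⇒p' = cases (P? m) (P? (suc m))
    where
    cases : Dec (P m) → Dec (P (suc m)) → count P? (2+ m) ≡ count Q? (2+ m)
    cases (yes pm) (yes pm') = begin
      count P? (2+ m)          ≡⟨ count-yes P? (suc m) pm' ⟩
      suc (count P? (suc m))   ≡⟨ cong suc (count-yes P? m pm) ⟩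
      2+ (count P? m)          ≡⟨ cong 2+ c≡ ⟩
      2+ (count Q? m)          ≡⟨ cong suc (count-yes Q? m (p'⇒q' pm')) ⟨
      suc (count Q? (suc m))   ≡⟨ count-yes Q? (suc m) (p⇒q pm) ⟨
      count Q? (2+ m)          ∎
    cases (yes pm) (no ¬pm') = begin
      count P? (2+ m)          ≡⟨ count-no P? (suc m) ¬pm' ⟩
      count P? (suc m)         ≡⟨ count-yes P? m pm ⟩
      suc (count P? m)         ≡⟨ cong suc c≡ ⟩
      suc (count Q? m)         ≡⟨ cong suc (count-no Q? m (¬pm' ∘ q'⇒p')) ⟨
      suc (count Q? (suc m))   ≡⟨ count-yes Q? (suc m) (p⇒q pm) ⟨
      count Q? (2+ m)          ∎
    cases (no ¬pm) (yes pm') = begin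
      count P? (2+ m)          ≡⟨ count-yes P? (suc m) pm' ⟩
      suc (count P? (suc m))   ≡⟨ cong suc (count-no P? m ¬pm) ⟩
      suc (count P? m)         ≡⟨ cong suc c≡ ⟩
      suc (count Q? m)         ≡⟨ count-yes Q? m (p'⇒q' pm') ⟨
      count Q? (suc m)         ≡⟨ count-no Q? (suc m) (¬pm ∘ q⇒p) ⟨
      count Q? (2+ m)          ∎
    cases (no ¬pm) (no ¬pm') = begin
      count P? (2+ m)          ≡⟨ count-no P? (suc m) ¬pm' ⟩
      count P? (suc m)         ≡⟨ count-no P? m ¬pm ⟩
      count P? m               ≡⟨ c≡ ⟩
      count Q? m               ≡⟨ count-no Q? m (¬pm' ∘ q'⇒p') ⟨
      count Q? (suc m)         ≡⟨ count-no Q? (suc m) (¬pm ∘ q⇒p) ⟨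
      count Q? (2+ m)          ∎

#below : (ℕ → ℕ) → ℕ → ℕ → ℕ
#below a k = count (λ i → a i <? k)

#below-yes : ∀ (a : ℕ → ℕ) {k} m → a m < k → #below a k (suc m) ≡ suc (#below a k m)
#below-yes a {k} = count-yes (λ i → a i <? k)

#below-no : ∀ (a : ℕ → ℕ) {k} m → ¬ a m < k → #below a k (suc m) ≡ #below a k m
#below-no a {k} = count-no (λ i → a i <? k)

#below-monoˡ : ∀ (a : ℕ → ℕ) {k k'} j → k ≤ k' → #below a k j ≤ #below a k' j
#below-monoˡ a j k≤k' = count-mono-⊆ _ _ j (λ i _ ai<k → <-≤-trans ai<k k≤k')

MapsBelow : ℕ → (ℕ → ℕ) → Set
MapsBelow n a = ∀ i → i < n → a i < n

InjectiveBelow : ℕ → (ℕ → ℕ) → Set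
InjectiveBelow n a = ∀ i i' → i < n → i' < n → a i ≡ a i' → i ≡ i'

#below-permutation : ∀ {n a} → MapsBelow n a → InjectiveBelow n a → ∀ k → k ≤ n → #below a k n ≡ k
#below-permutation {n} {a} into inj k k≤n = ≤-antisym at-most at-least
  where
  at-most : #below a k n ≤ k
  at-most = count-injective-≤ _ n k a (λ i _ ai<k → ai<k) (λ i i' i<n i'<n _ _ → inj i i' i<n i'<n)

  large-at-most : count (∁? (λ i → a i <? k)) n ≤ n ∸ k
  large-at-most = count-injective-≤ _ n (n ∸ k) (λ i → a i ∸ k)
    (λ i i<n ai≮k → ∸-monoˡ-< (into i i<n) (≮⇒≥ ai≮k))
    (λ i i' i<n i'<n ai≮k ai'≮k e → inj i i' i<n i'<n (begin
      a i           ≡⟨ m∸n+n≡m (≮⇒≥ ai≮k) ⟨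
      a i ∸ k + k   ≡⟨ cong (_+ k) e ⟩
      a i' ∸ k + k  ≡⟨ m∸n+n≡m (≮⇒≥ ai'≮k) ⟩
      a i'          ∎))
    where open ≡-Reasoning

  at-least : k ≤ #below a k n
  at-least = +-cancelʳ-≤ (n ∸ k) k (#below a k n) (begin
    k + (n ∸ k)                                  ≡⟨ m+[n∸m]≡n k≤n ⟩
    n                                            ≡⟨ count-∁ _ n ⟨
    #below a k n + count (∁? (λ i → a i <? k)) n ≤⟨ +-monoʳ-≤ (#below a k n) large-at-most ⟩
    #below a k n + (n ∸ k)                       ∎)
    where open ≤-Reasoning

injective-deflationary⇒id : ∀ {n a} → InjectiveBelow n a → (∀ i → i < n → a i ≤ i) →
                            ∀ i → i < n → a i ≡ i
injective-deflationary⇒id {n} {a} inj ai≤i = <-rec (λ i → i < n → a i ≡ i) fixed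
  where
  fixed : ∀ i → (∀ {j} → j < i → j < n → a j ≡ j) → i < n → a i ≡ i
  fixed i rec i<n with m≤n⇒m<n∨m≡n (ai≤i i i<n)
  ... | inj₂ ai≡i = ai≡i
  ... | inj₁ ai<i = contradiction (inj (a i) i ai<n i<n (rec ai<i ai<n)) (<⇒≢ ai<i)
    where ai<n = <-trans ai<i i<n

dist-refl : ∀ i → dist i i ≡ 0
dist-refl i rewrite n∸n≡0 i = refl

dist-suc : ∀ i → dist i (suc i) ≡ 1
dist-suc zero    = refl
dist-suc (suc i) = dist-suc i

dist-sucˡ : ∀ i → dist (suc i) i ≡ 1
dist-sucˡ zero    = refl
dist-sucˡ (suc i) = dist-sucˡ i

≤-dist+ : ∀ a b → b ≤ a + dist a b
≤-dist+ a b = ≤-trans (m≤n+m∸n b a) (+-monoʳ-≤ a (m≤n+m (b ∸ a) (a ∸ b)))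

≤-dist+ˡ : ∀ a b → a ≤ b + dist a b
≤-dist+ˡ a b = ≤-trans (m≤n+m∸n a b) (+-monoʳ-≤ b (m≤m+n (a ∸ b) (b ∸ a)))

-- Compare-exchange rounds and the block-phased sort

parity-suc : ∀ m → parity (suc m) ≡ parity m ⁻¹
parity-suc m = trans (sym (ℙ.⁻¹-involutive _)) (cong _⁻¹ (ℙ.suc-homo-⁻¹ m))

parity-double : ∀ m → parity (m + m) ≡ 0ℙ
parity-double m = trans (ℙ.+-homo-+ m m) (ℙ.p+p≡0ℙ (parity m))

parity-+-double : ∀ m c → parity (m + (c + c)) ≡ parity m
parity-+-double m c = begin
  parity (m + (c + c))         ≡⟨ ℙ.+-homo-+ m (c + c) ⟩
  parity m ℙ.+ parity (c + c)  ≡⟨ cong (parity m ℙ.+_) (parity-double c) ⟩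
  parity m ℙ.+ 0ℙ              ≡⟨ ℙ.+-identityʳ (parity m) ⟩
  parity m                     ∎
  where open ≡-Reasoning

parity-odd : ∀ m → parity (suc (m + m)) ≡ 1ℙ
parity-odd m = trans (parity-suc (m + m)) (cong _⁻¹ (parity-double m))

parity-odd+odd : ∀ m n → parity m ≡ 1ℙ → parity n ≡ 1ℙ → parity (m + n) ≡ 0ℙ
parity-odd+odd m n pm pn = trans (ℙ.+-homo-+ m n) (cong₂ ℙ._+_ pm pn)

≢0ℙ⇒≡1ℙ : ∀ {p} → p ≢ 0ℙ → p ≡ 1ℙ
≢0ℙ⇒≡1ℙ {0ℙ} ne = contradiction refl ne
≢0ℙ⇒≡1ℙ {1ℙ} _  = refl

≢1ℙ⇒≡0ℙ : ∀ {p} → p ≢ 1ℙ → p ≡ 0ℙ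
≢1ℙ⇒≡0ℙ {0ℙ} _  = refl
≢1ℙ⇒≡0ℙ {1ℙ} ne = contradiction refl ne

even-≤-odd⇒< : ∀ {m x} → parity m ≡ 0ℙ → m ≤ suc (x + x) → m < suc (x + x)
even-≤-odd⇒< {m} {x} pm m≤ = ≤∧≢⇒< m≤ λ m≡ →
  contradiction (trans (sym pm) (trans (cong parity m≡) (parity-odd x))) λ ()

-- Comparator j compares positions j ∸ 1 and j; sparseness makes the exchanged pairs disjoint.
module ExchangeRound (Active : Pred ℕ 0ℓ) (active? : Decidable Active)
             (sparse : ∀ j → Active j → ¬ Active (suc j)) (a : ℕ → ℕ) where

  Swaps : Pred ℕ 0ℓ
  Swaps zero    = ⊥
  Swaps (suc i) = Active (suc i) × a (suc i) < a i

  swaps? : Decidable Swaps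
  swaps? zero    = no λ ()
  swaps? (suc i) = active? (suc i) ×-dec (a (suc i) <? a i)

  ¬active⇒¬swaps : ∀ j → ¬ Active j → ¬ Swaps j
  ¬active⇒¬swaps (suc i) ¬act (act , _) = ¬act act

  swaps-sparse : ∀ j → Swaps j → ¬ Swaps (suc j)
  swaps-sparse (suc i) (act , _) (act' , _) = sparse (suc i) act act'

  partner : ℕ → ℕ
  partner i with swaps? (suc i) | swaps? i
  ... | yes _ | _     = suc i
  ... | no  _ | yes _ = pred i
  ... | no  _ | no  _ = i

  next : ℕ → ℕ
  next i = a (partner i)

  partner-up : ∀ {i} → Swaps (suc i) → partner i ≡ suc i
  partner-up {i} s with swaps? (suc i) | swaps? i
  ... | yes _  | _ = refl
  ... | no ¬s  | _ = contradiction s ¬s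

  partner-down : ∀ {i} → ¬ Swaps (suc i) → Swaps i → partner i ≡ pred i
  partner-down {i} ¬s s with swaps? (suc i) | swaps? i
  ... | yes s' | _     = contradiction s' ¬s
  ... | no  _  | yes _ = refl
  ... | no  _  | no ¬s' = contradiction s ¬s'

  partner-fixed : ∀ {i} → ¬ Swaps (suc i) → ¬ Swaps i → partner i ≡ i
  partner-fixed {i} ¬s ¬s' with swaps? (suc i) | swaps? i
  ... | yes s | _     = contradiction s ¬s
  ... | no  _ | yes s = contradiction s ¬s'
  ... | no  _ | no  _ = refl

  partner-involutive : ∀ i → partner (partner i) ≡ i
  partner-involutive i = cases i (swaps? (suc i)) (swaps? i)
    where
    cases : ∀ i → Dec (Swaps (suc i)) → Dec (Swaps i) → partner (partner i) ≡ i
    cases i (yes s) _ = trans (cong partner (partner-up s)) (partner-down (swaps-sparse (suc i) s) s)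
    cases (suc i) (no ¬s) (yes s) = trans (cong partner (partner-down ¬s s)) (partner-up s)
    cases i (no ¬s) (no ¬s') = trans (cong partner (partner-fixed ¬s ¬s')) (partner-fixed ¬s ¬s')

  partner-near : ∀ i → dist i (partner i) ≤ 1
  partner-near i = cases i (swaps? (suc i)) (swaps? i)
    where
    cases : ∀ i → Dec (Swaps (suc i)) → Dec (Swaps i) → dist i (partner i) ≤ 1
    cases i (yes s) _ rewrite partner-up s = ≤-reflexive (dist-suc i)
    cases (suc i) (no ¬s) (yes s) rewrite partner-down ¬s s = ≤-reflexive (dist-sucˡ i)
    cases i (no ¬s) (no ¬s') rewrite partner-fixed ¬s ¬s' = ≤-trans (≤-reflexive (dist-refl i)) z≤n

  partner-range : ∀ {n} → (∀ j → Active j → j < n) → ∀ i → i < n → partner i < n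
  partner-range {n} active<n i = cases i (swaps? (suc i)) (swaps? i)
    where
    cases : ∀ i → Dec (Swaps (suc i)) → Dec (Swaps i) → i < n → partner i < n
    cases i (yes s@(act , _)) _ _ rewrite partner-up s = active<n (suc i) act
    cases (suc i) (no ¬s) (yes s) i<n rewrite partner-down ¬s s = <-trans (n<1+n i) i<n
    cases i (no ¬s) (no ¬s') i<n rewrite partner-fixed ¬s ¬s' = i<n

  #below-next-fixed : ∀ k j → ¬ Swaps j → #below next k j ≡ #below a k j
  #below-next-fixed k zero    _  = refl
  #below-next-fixed k (suc i) ¬s = cases i ¬s (swaps? i)
    where
    cases : ∀ i → ¬ Swaps (suc i) → Dec (Swaps i) → #below next k (suc i) ≡ #below a k (suc i)
    cases i ¬s (no ¬s') = count-cong-suc _ _ i (#below-next-fixed k i ¬s')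
      (subst (_< k) (cong a (partner-fixed ¬s ¬s')))
      (subst (_< k) (cong a (sym (partner-fixed ¬s ¬s'))))
    cases (suc i) ¬s (yes s) = count-swap-last-two _ _ i
      (#below-next-fixed k i (λ s' → swaps-sparse i s' s))
      (subst (_< k) (cong a (partner-up s)))
      (subst (_< k) (cong a (sym (partner-up s))))
      (subst (_< k) (cong a (partner-down ¬s s)))
      (subst (_< k) (cong a (sym (partner-down ¬s s))))

  ¬swaps-before-active : ∀ i → Active (suc i) → ¬ Swaps i
  ¬swaps-before-active (suc i) act (act' , _) = sparse (suc i) act' act

  #below-next-active : ∀ k i → Active (suc i) →
    #below next k (suc i) ≡ suc (#below a k i) ⊎ #below next k (suc i) ≡ #below a k (suc (suc i))
  #below-next-active k i act = cases (swaps? (suc i)) (a (suc i) <? k) (a i <? k)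
    where
    open ≡-Reasoning
    Outcome = #below next k (suc i) ≡ suc (#below a k i) ⊎ #below next k (suc i) ≡ #below a k (suc (suc i))

    unchanged-before : #below next k i ≡ #below a k i
    unchanged-before = #below-next-fixed k i (¬swaps-before-active i act)

    cases : Dec (Swaps (suc i)) → Dec (a (suc i) < k) → Dec (a i < k) → Outcome
    cases (yes s) (yes a₊<k) _ = inj₁ (begin
      #below next k (suc i) ≡⟨ #below-yes next i (subst (_< k) (cong a (sym (partner-up s))) a₊<k) ⟩
      suc (#below next k i) ≡⟨ cong suc unchanged-before ⟩
      suc (#below a k i)    ∎)
    cases (yes s@(_ , a₊<a)) (no a₊≮k) _ = inj₂ (begin
      #below next k (suc i)     ≡⟨ #below-no next i (a₊≮k ∘ subst (_< k) (cong a (partner-up s))) ⟩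
      #below next k i           ≡⟨ unchanged-before ⟩
      #below a k i              ≡⟨ #below-no a i (λ a<k → a₊≮k (<-trans a₊<a a<k)) ⟨
      #below a k (suc i)        ≡⟨ #below-no a (suc i) a₊≮k ⟨
      #below a k (suc (suc i))  ∎)
    cases (no ¬s) _ (yes a<k) = inj₁ (trans (#below-next-fixed k (suc i) ¬s) (#below-yes a i a<k))
    cases (no ¬s) _ (no a≮k) = inj₂ (begin
      #below next k (suc i)     ≡⟨ #below-next-fixed k (suc i) ¬s ⟩
      #below a k (suc i)        ≡⟨ #below-no a (suc i) (λ a₊<k → a≮k (≤-<-trans (≮⇒≥ (¬s ∘ (act ,_))) a₊<k)) ⟨
      #below a k (suc (suc i))  ∎)

module BlockwiseOddEvenSort (n w : ℕ) (a₀ : ℕ → ℕ) (into : MapsBelow n a₀) (inj : InjectiveBelow n a₀)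
                (near : ∀ i → i < n → dist i (a₀ i) ≤ w) (1≤w : 1 ≤ w) where

  a₀≤i+w : ∀ i → i < n → a₀ i ≤ i + w
  a₀≤i+w i i<n = ≤-trans (≤-dist+ i (a₀ i)) (+-monoʳ-≤ i (near i i<n))

  i≤a₀+w : ∀ i → i < n → i ≤ a₀ i + w
  i≤a₀+w i i<n = ≤-trans (≤-dist+ˡ i (a₀ i)) (+-monoʳ-≤ (a₀ i) (near i i<n))

  Split : Pred ℕ 0ℓ
  Split s = #below a₀ s s ≡ s

  split? : Decidable Split
  split? s = #below a₀ s s ≟ s

  blockStart : ℕ → ℕ
  blockStart zero = zero
  blockStart (suc j) with split? j
  ... | yes _ = j
  ... | no  _ = blockStart j

  blockStart-split : ∀ j → Split (blockStart j)
  blockStart-split zero = refl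
  blockStart-split (suc j) with split? j
  ... | yes split = split
  ... | no  _     = blockStart-split j

  blockStart-< : ∀ j → 1 ≤ j → blockStart j < j
  blockStart-< (suc j) _ with split? j
  ... | yes _ = ≤-refl
  blockStart-< (suc zero)    _ | no ¬split = contradiction refl ¬split
  blockStart-< (suc (suc j)) _ | no _      = m<n⇒m<1+n (blockStart-< (suc j) (s≤s z≤n))

  blockStart-maximal : ∀ {s j} → Split s → s < j → s ≤ blockStart j
  blockStart-maximal {s} {suc j} split s<1+j with split? j
  ... | yes _ = ≤-pred s<1+j
  ... | no ¬split with m≤n⇒m<n∨m≡n (≤-pred s<1+j)
  ...   | inj₁ s<j  = blockStart-maximal split s<j
  ...   | inj₂ refl = contradiction split ¬split

  blockStart-unsplit : ∀ {j} → ¬ Split j → blockStart (suc j) ≡ blockStart j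
  blockStart-unsplit {j} ¬split with split? j
  ... | yes split = contradiction split ¬split
  ... | no  _     = refl

  Active : ℕ → Pred ℕ 0ℓ
  Active t j = j < n × ¬ Split j × parity (j + t + blockStart j + w) ≡ 0ℙ

  active? : ∀ t → Decidable (Active t)
  active? t j = j <? n ×-dec ¬? (split? j) ×-dec (parity (j + t + blockStart j + w) ℙ.≟ 0ℙ)

  active-sparse : ∀ t j → Active t j → ¬ Active t (suc j)
  active-sparse t j (_ , ¬split , even) (_ , _ , even') = contradiction (begin
    0ℙ                                           ≡⟨ even' ⟨
    parity (suc j + t + blockStart (suc j) + w)  ≡⟨ cong (λ b → parity (suc j + t + b + w))
                                                         (blockStart-unsplit ¬split) ⟩
    parity (suc (j + t + blockStart j + w))      ≡⟨ parity-suc (j + t + blockStart j + w) ⟩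
    parity (j + t + blockStart j + w) ⁻¹         ≡⟨ cong _⁻¹ even ⟩
    1ℙ                                           ∎) λ ()
    where open ≡-Reasoning

  module R (t : ℕ) = ExchangeRound (Active t) (active? t) (active-sparse t)

  arrangement : ℕ → ℕ → ℕ
  arrangement zero    = a₀
  arrangement (suc t) = R.next t (arrangement t)

  layer : ℕ → ℕ → ℕ
  layer t = R.partner t (arrangement t)

  layer-range : ∀ t i → i < n → layer t i < n
  layer-range t = R.partner-range t (arrangement t) (λ j → proj₁)

  arrangement-into : ∀ t → MapsBelow n (arrangement t)
  arrangement-into zero    = into
  arrangement-into (suc t) i i<n = arrangement-into t (layer t i) (layer-range t i i<n)

  arrangement-injective : ∀ t → InjectiveBelow n (arrangement t)
  arrangement-injective zero = inj
  arrangement-injective (suc t) i i' i<n i'<n e = begin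
    i                     ≡⟨ R.partner-involutive t _ i ⟨
    layer t (layer t i)   ≡⟨ cong (layer t) layers-equal ⟩
    layer t (layer t i')  ≡⟨ R.partner-involutive t _ i' ⟩
    i'                    ∎
    where
    open ≡-Reasoning
    layers-equal : layer t i ≡ layer t i'
    layers-equal = arrangement-injective t _ _ (layer-range t i i<n) (layer-range t i' i'<n) e

  #below-never-active : ∀ {j} → (∀ t → ¬ Active t j) → ∀ t k → #below (arrangement t) k j ≡ #below a₀ k j
  #below-never-active never zero    k = refl
  #below-never-active {j} never (suc t) k =
    trans (R.#below-next-fixed t (arrangement t) k j (R.¬active⇒¬swaps t (arrangement t) j (never t)))
          (#below-never-active never t k)

  #below-total : ∀ t k → k ≤ n → #below (arrangement t) k n ≡ k
  #below-total t = #below-permutation (arrangement-into t) (arrangement-injective t)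

  #below-split : ∀ {s} → Split s → ∀ t k → #below (arrangement t) k s ≡ #below a₀ k s
  #below-split split = #below-never-active λ t act → proj₁ (proj₂ act) split

  split-closed : ∀ {s} → Split s → ∀ t i → i < s → arrangement t i < s
  split-closed {s} split t = count-all⁻ _ s (≤-reflexive (sym (trans (#below-split split t s) split)))

  split-above : ∀ {s} → Split s → s ≤ n → ∀ i → s ≤ i → i < n → s ≤ a₀ i
  split-above {s} split s≤n i s≤i i<n = ≮⇒≥
    (count-none⁻ (λ i → a₀ i <? s) (≤-reflexive (trans (#below-total 0 s s≤n) (sym split))) i s≤i i<n)

  #below₀-split : ∀ {s k} → Split s → s ≤ n → k ≤ s → #below a₀ k s ≡ k
  #below₀-split {s} {k} split s≤n k≤s = trans
    (sym (count-none _ s≤n λ i s≤i i<n a₀i<k → <⇒≱ (<-≤-trans a₀i<k k≤s) (split-above split s≤n i s≤i i<n)))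
    (#below-total 0 k (≤-trans k≤s s≤n))

  settled-below-split : ∀ {s k j} → Split s → s ≤ k → j ≤ s → ∀ t → #below (arrangement t) k j ≡ j
  settled-below-split split s≤k j≤s t = count-all _ _ λ i i<j →
    <-≤-trans (split-closed split t i (<-≤-trans i<j j≤s)) s≤k

  settled-above-split : ∀ {s k j} → Split s → s ≤ n → k ≤ s → s ≤ j → ∀ t → k ≤ #below (arrangement t) k j
  settled-above-split {s} {k} {j} split s≤n k≤s s≤j t = begin
    k                              ≡⟨ #below₀-split split s≤n k≤s ⟨
    #below a₀ k s                  ≡⟨ #below-split split t k ⟨
    #below (arrangement t) k s     ≤⟨ count-monoʳ _ s≤j ⟩
    #below (arrangement t) k j     ∎
    where open ≤-Reasoning

  #below₀-short : ∀ {k m} → m ≤ n → m + w ≤ k → #below a₀ k m ≡ m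
  #below₀-short {k} {m} m≤n m+w≤k = count-all _ m λ i i<m →
    <-≤-trans (≤-<-trans (a₀≤i+w i (<-≤-trans i<m m≤n)) (+-monoˡ-< w i<m)) m+w≤k

  #below₀-long : ∀ {m j} → m ≤ n → j ≤ n → m + w ≤ j → #below a₀ m j ≡ m
  #below₀-long {m} {j} m≤n j≤n m+w≤j = trans (sym (count-none _ j≤n large)) (#below-total 0 m m≤n)
    where
    large : ∀ i → j ≤ i → i < n → ¬ a₀ i < m
    large i j≤i i<n a₀i<m = <⇒≱ (<-≤-trans (≤-<-trans (i≤a₀+w i i<n) (+-monoˡ-< w a₀i<m)) m+w≤j) j≤i

  k≤#below₀+w : ∀ {k j} → j ≤ n → k ≤ j + w → k ≤ #below a₀ k j + w
  k≤#below₀+w {k} {j} j≤n k≤j+w with w ≤? k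
  ... | no w≰k = ≤-trans (<⇒≤ (≰⇒> w≰k)) (m≤n+m w _)
  ... | yes w≤k = begin
    k                        ≡⟨ m∸n+n≡m w≤k ⟨
    k ∸ w + w                ≡⟨ cong (_+ w) all-below ⟨
    #below a₀ k (k ∸ w) + w  ≤⟨ +-monoˡ-≤ w (count-monoʳ _ k∸w≤j) ⟩
    #below a₀ k j + w        ∎
    where
    open ≤-Reasoning
    k∸w≤j : k ∸ w ≤ j
    k∸w≤j = m≤n+o⇒m∸n≤o k w (subst (k ≤_) (+-comm j w) k≤j+w)
    all-below : #below a₀ k (k ∸ w) ≡ k ∸ w
    all-below = #below₀-short (≤-trans k∸w≤j j≤n) (≤-reflexive (m∸n+n≡m w≤k))

  j≤#below₀+w : ∀ {k j} → k ≤ n → j ≤ n → j ≤ k + w → j ≤ #below a₀ k j + w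
  j≤#below₀+w {k} {j} k≤n j≤n j≤k+w with w ≤? j
  ... | no w≰j = ≤-trans (<⇒≤ (≰⇒> w≰j)) (m≤n+m w _)
  ... | yes w≤j = begin
    j                        ≡⟨ m∸n+n≡m w≤j ⟨
    j ∸ w + w                ≡⟨ cong (_+ w) all-small ⟨
    #below a₀ (j ∸ w) j + w  ≤⟨ +-monoˡ-≤ w (#below-monoˡ a₀ j j∸w≤k) ⟩
    #below a₀ k j + w        ∎
    where
    open ≤-Reasoning
    j∸w≤k : j ∸ w ≤ k
    j∸w≤k = m≤n+o⇒m∸n≤o j w (subst (j ≤_) (+-comm k w) j≤k+w)
    all-small : #below a₀ (j ∸ w) j ≡ j ∸ w
    all-small = #below₀-long (≤-trans j∸w≤k k≤n) j≤n (≤-reflexive (m∸n+n≡m w≤j))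

  Settled : ℕ → ℕ → ℕ → Set
  Settled k j z = j ≤ z ⊎ k ≤ z

  -- For a threshold k, z counts the entries below k among the first j positions after t rounds, and
  -- Settled says that z has reached its final value min j k. Every round preserves the bound (at idle
  -- comparators because the offset e makes its left side even), and once e + t ≥ 2w it excludes
  -- everything but Settled.
  Progress : ℕ → ℕ → ℕ → ℕ → ℕ → Set
  Progress e t k j z = Settled k j z ⊎ j + k + e + t ≤ suc ((z + w) + (z + w))

  progress-shift : ∀ {e t k i z} → Progress e t k i z → Progress e (suc t) k (suc i) (suc z)
  progress-shift (inj₁ (inj₁ i≤z)) = inj₁ (inj₁ (s≤s i≤z))
  progress-shift (inj₁ (inj₂ k≤z)) = inj₁ (inj₂ (m≤n⇒m≤1+n k≤z))
  progress-shift {e} {t} {k} {i} {z} (inj₂ bound) =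
    inj₂ (subst₂ _≤_ (lhs i k e t) (rhs z w) (s≤s (s≤s bound)))
    where
    lhs : ∀ i k e t → suc (suc (i + k + e + t)) ≡ suc i + k + e + suc t
    lhs = solve-∀
    rhs : ∀ z w → suc (suc (suc ((z + w) + (z + w)))) ≡ suc ((suc z + w) + (suc z + w))
    rhs = solve-∀

  progress-pull : ∀ {e t k i z} → Progress e t k (suc (suc i)) z → Progress e (suc t) k (suc i) z
  progress-pull (inj₁ (inj₁ 2+i≤z)) = inj₁ (inj₁ (<⇒≤ 2+i≤z))
  progress-pull (inj₁ (inj₂ k≤z)) = inj₁ (inj₂ k≤z)
  progress-pull {e} {t} {k} {i} {z} (inj₂ bound) =
    inj₂ (subst (_≤ suc ((z + w) + (z + w))) (shift i k e t) bound)
    where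
    shift : ∀ i k e t → suc (suc i) + k + e + t ≡ suc i + k + e + suc t
    shift = solve-∀

  progress-wait : ∀ {e t k j z} → parity (j + k + e + t) ≡ 0ℙ →
                  Progress e t k j z → Progress e (suc t) k j z
  progress-wait even (inj₁ settled) = inj₁ settled
  progress-wait {e} {t} {k} {j} {z} even (inj₂ bound) =
    inj₂ (subst (_≤ suc ((z + w) + (z + w))) (sym (+-suc (j + k + e) t))
                (even-≤-odd⇒< {x = z + w} even bound))

  progress-done : ∀ {e t k j z} → 2 * w ≤ e + t → Progress e t k j z → Settled k j z
  progress-done _ (inj₁ settled) = settled
  progress-done {e} {t} {k} {j} {z} 2w≤e+t (inj₂ bound) with j ≤? z | k ≤? z
  ... | yes j≤z | _       = inj₁ j≤z
  ... | no _    | yes k≤z = inj₂ k≤z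
  ... | no j≰z  | no k≰z  = contradiction (begin
    suc (suc ((z + w) + (z + w))) ≡⟨ regroup z w ⟩
    (suc z + suc z) + 2 * w       ≤⟨ +-mono-≤ (+-mono-≤ (≰⇒> j≰z) (≰⇒> k≰z)) 2w≤e+t ⟩
    (j + k) + (e + t)             ≡⟨ +-assoc (j + k) e t ⟨
    j + k + e + t                 ≤⟨ bound ⟩
    suc ((z + w) + (z + w))       ∎) (<-irrefl refl)
    where
    open ≤-Reasoning
    regroup : ∀ z w → suc (suc ((z + w) + (z + w))) ≡ (suc z + suc z) + 2 * w
    regroup = solve-∀

  initial-settled-or-close : ∀ {k j} → k ≤ n → j ≤ n →
    Settled k j (#below a₀ k j) ⊎ (j ≤ #below a₀ k j + w × k ≤ #below a₀ k j + w)
  initial-settled-or-close {k} {j} k≤n j≤n with j + w ≤? k | k + w ≤? j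
  ... | yes j+w≤k | _         = inj₁ (inj₁ (≤-reflexive (sym (#below₀-short j≤n j+w≤k))))
  ... | no _      | yes k+w≤j = inj₁ (inj₂ (≤-reflexive (sym (#below₀-long k≤n j≤n k+w≤j))))
  ... | no j+w≰k  | no k+w≰j  =
    inj₂ (j≤#below₀+w k≤n j≤n (<⇒≤ (≰⇒> k+w≰j)) , k≤#below₀+w j≤n (<⇒≤ (≰⇒> j+w≰k)))

  initial-progress₁ : ∀ {k j} → k ≤ n → j ≤ n → Progress 1 0 k j (#below a₀ k j)
  initial-progress₁ {k} {j} k≤n j≤n with initial-settled-or-close k≤n j≤n
  ... | inj₁ settled = inj₁ settled
  ... | inj₂ (j≤x , k≤x) = inj₂ (subst (_≤ suc (x + x)) (sym (normalise j k)) (s≤s (+-mono-≤ j≤x k≤x)))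
    where
    x = #below a₀ k j + w
    normalise : ∀ j k → j + k + 1 + 0 ≡ suc (j + k)
    normalise = solve-∀

  initial-progress₂ : ∀ {k j} → k ≤ n → j ≤ n → #below a₀ k k + w ≢ k → Progress 2 0 k j (#below a₀ k j)
  initial-progress₂ {k} {j} k≤n j≤n not-critical with initial-settled-or-close k≤n j≤n
  ... | inj₁ settled = inj₁ settled
  ... | inj₂ (j≤x , k≤x) = inj₂ (subst (_≤ suc (x + x)) (sym (normalise j k)) (s≤s strict))
    where
    x = #below a₀ k j + w
    normalise : ∀ j k → j + k + 2 + 0 ≡ suc (suc (j + k))
    normalise = solve-∀
    strict : suc (j + k) ≤ x + x
    strict with j <? x | k <? x
    ... | yes j<x | _       = +-mono-≤ j<x k≤x
    ... | no _    | yes k<x = subst (_≤ x + x) (+-suc j k) (+-mono-≤ j≤x k<x)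
    ... | no j≮x  | no k≮x  = contradiction (begin
      #below a₀ k k + w  ≡⟨ cong (λ i → #below a₀ k i + w) j≡k ⟨
      x                  ≡⟨ ≤-antisym k≤x (≮⇒≥ k≮x) ⟨
      k                  ∎) not-critical
      where
      open ≡-Reasoning
      j≡k : j ≡ k
      j≡k = trans (≤-antisym j≤x (≮⇒≥ j≮x)) (≤-antisym (≮⇒≥ k≮x) k≤x)

  -- The offset e ∈ {1, 2} of a threshold k is chosen to match the phase of the block of k.
  Aligned : ℕ → ℕ → Set
  Aligned e k = parity (k + e + blockStart k + w) ≡ 1ℙ

  alignment : ∀ k → Aligned 1 k ⊎ Aligned 2 k
  alignment k with parity (k + 1 + blockStart k + w) ℙ.≟ 1ℙ
  ... | yes odd = inj₁ odd
  ... | no ¬odd = inj₂ (begin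
    parity (k + 2 + blockStart k + w)        ≡⟨ cong parity (shift k (blockStart k) w) ⟩
    parity (suc (k + 1 + blockStart k + w))  ≡⟨ parity-suc (k + 1 + blockStart k + w) ⟩
    parity (k + 1 + blockStart k + w) ⁻¹     ≡⟨ cong _⁻¹ (≢1ℙ⇒≡0ℙ ¬odd) ⟩
    1ℙ                                       ∎)
    where
    open ≡-Reasoning
    shift : ∀ k b w → k + 2 + b + w ≡ suc (k + 1 + b + w)
    shift = solve-∀

  -- Offset 2 would leave no slack at a critical threshold, but there the block starts w before k,
  -- which selects offset 1.
  critical-blockStart : ∀ {k} → k ≤ n → #below a₀ k k + w ≡ k → blockStart k ≡ k ∸ w
  critical-blockStart {k} k≤n critical = ≤-antisym blockStart≤m (blockStart-maximal split-m m<k)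
    where
    w≤k : w ≤ k
    w≤k = subst (w ≤_) critical (m≤n+m w _)
    m = k ∸ w
    m+w≡k : m + w ≡ k
    m+w≡k = m∸n+n≡m w≤k
    m<k : m < k
    m<k = subst (m <_) m+w≡k (m<m+n m 1≤w)
    m≤n : m ≤ n
    m≤n = ≤-trans (<⇒≤ m<k) k≤n

    gap : ∀ i → m ≤ i → i < k → k ≤ a₀ i
    gap i m≤i i<k = ≮⇒≥ (count-none⁻ _ (≤-reflexive (begin
      #below a₀ k k  ≡⟨ +-cancelʳ-≡ w _ _ (trans critical (sym m+w≡k)) ⟩
      m              ≡⟨ #below₀-short m≤n (≤-reflexive m+w≡k) ⟨
      #below a₀ k m  ∎)) i m≤i i<k)
      where open ≡-Reasoning

    split-m : Split m
    split-m = trans (sym (count-none _ m≤n large)) (#below-total 0 m m≤n)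
      where
      large : ∀ i → m ≤ i → i < n → ¬ a₀ i < m
      large i m≤i i<n a₀i<m = <⇒≱ (<-trans a₀i<m m<k) (gap i m≤i i<k)
        where
        i<k : i < k
        i<k = subst (i <_) m+w≡k (≤-<-trans (i≤a₀+w i i<n) (+-monoˡ-< w a₀i<m))

    no-split-inside : ∀ s → m < s → s < k → ¬ Split s
    no-split-inside (suc b) m<1+b 1+b<k split =
      <⇒≱ (<-≤-trans (split-closed split 0 b ≤-refl) (<⇒≤ 1+b<k))
          (gap b (≤-pred m<1+b) (<-trans (n<1+n b) 1+b<k))

    blockStart≤m : blockStart k ≤ m
    blockStart≤m = ≮⇒≥ λ m<b →
      no-split-inside (blockStart k) m<b (blockStart-< k (≤-trans 1≤w w≤k)) (blockStart-split k)

  aligned₂⇒not-critical : ∀ {k} → k ≤ n → Aligned 2 k → #below a₀ k k + w ≢ k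
  aligned₂⇒not-critical {k} k≤n aligned critical = contradiction (begin
    0ℙ                                   ≡⟨ parity-+-double 2 k ⟨
    parity (2 + (k + k))                 ≡⟨ cong parity (regroup k w w≤k) ⟩
    parity (k + 2 + (k ∸ w) + w)         ≡⟨ cong (λ b → parity (k + 2 + b + w))
                                                 (critical-blockStart k≤n critical) ⟨
    parity (k + 2 + blockStart k + w)    ≡⟨ aligned ⟩
    1ℙ                                   ∎) λ ()
    where
    open ≡-Reasoning
    w≤k : w ≤ k
    w≤k = subst (w ≤_) critical (m≤n+m w _)
    regroup : ∀ k w → w ≤ k → 2 + (k + k) ≡ k + 2 + (k ∸ w) + w
    regroup k w w≤k = begin
      2 + (k + k)              ≡⟨ solve₁ k ⟩
      k + 2 + k                ≡⟨ cong (k + 2 +_) (m∸n+n≡m w≤k) ⟨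
      k + 2 + (k ∸ w + w)      ≡⟨ +-assoc (k + 2) (k ∸ w) w ⟨
      k + 2 + (k ∸ w) + w      ∎
      where
      solve₁ : ∀ k → 2 + (k + k) ≡ k + 2 + k
      solve₁ = solve-∀

  unsplit-positive : ∀ {k} → ¬ Split k → 1 ≤ k
  unsplit-positive {zero}  ¬split = contradiction refl ¬split
  unsplit-positive {suc k} _      = s≤s z≤n

  same-block-or-settled : ∀ {k j} t → k ≤ n → ¬ Split k → 1 ≤ j → j ≤ n →
    blockStart j ≡ blockStart k ⊎ Settled k j (#below (arrangement t) k j)
  same-block-or-settled {k} {j} t k≤n ¬split 1≤j j≤n with j ≤? k
  ... | yes j≤k with j ≤? blockStart k
  ...   | yes j≤b = inj₂ (inj₁ (≤-reflexive (sym
            (settled-below-split (blockStart-split k) (<⇒≤ (blockStart-< k (unsplit-positive ¬split))) j≤b t))))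
  ...   | no j≰b = inj₁ (≤-antisym
            (blockStart-maximal (blockStart-split j) (<-≤-trans (blockStart-< j 1≤j) j≤k))
            (blockStart-maximal (blockStart-split k) (≰⇒> j≰b)))
  same-block-or-settled {k} {j} t k≤n ¬split 1≤j j≤n | no j≰k with <-cmp (blockStart j) k
  ... | tri< bⱼ<k _ _ = inj₁ (≤-antisym
          (blockStart-maximal (blockStart-split j) bⱼ<k)
          (blockStart-maximal (blockStart-split k) (<-trans (blockStart-< k (unsplit-positive ¬split)) (≰⇒> j≰k))))
  ... | tri≈ _ bⱼ≡k _ = contradiction (subst Split bⱼ≡k (blockStart-split j)) ¬split
  ... | tri> _ _ k<bⱼ = inj₂ (inj₂ (settled-above-split (blockStart-split j)
          (≤-trans (<⇒≤ (blockStart-< j 1≤j)) j≤n) (<⇒≤ k<bⱼ) (<⇒≤ (blockStart-< j 1≤j)) t))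

  inactive-settled-or-even : ∀ {e t k j} → Aligned e k → k ≤ n → ¬ Split k → 1 ≤ j → j ≤ n → ¬ Active t j →
    (∀ t' → Settled k j (#below (arrangement t') k j)) ⊎ parity (j + k + e + t) ≡ 0ℙ
  inactive-settled-or-even {e} {t} {k} {j} aligned k≤n ¬split 1≤j j≤n inactive
    with j <? n | split? j | parity (j + t + blockStart j + w) ℙ.≟ 0ℙ
  ... | no j≮n | _ | _ = inj₁ λ t' → inj₂ (≤-reflexive (sym (begin
    #below (arrangement t') k j  ≡⟨ cong (#below (arrangement t') k) (≤-antisym j≤n (≮⇒≥ j≮n)) ⟩
    #below (arrangement t') k n  ≡⟨ #below-total t' k k≤n ⟩
    k                            ∎)))
    where open ≡-Reasoning
  ... | yes _ | yes split | _ with j ≤? k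
  ...   | yes j≤k = inj₁ λ t' → inj₁ (≤-reflexive (sym (settled-below-split split j≤k ≤-refl t')))
  ...   | no j≰k  = inj₁ λ t' → inj₂ (settled-above-split split j≤n (<⇒≤ (≰⇒> j≰k)) ≤-refl t')
  inactive-settled-or-even {e} {t} {k} {j} aligned k≤n ¬split 1≤j j≤n inactive
    | yes j<n | no ¬splitⱼ | yes even = contradiction (j<n , ¬splitⱼ , even) inactive
  inactive-settled-or-even {e} {t} {k} {j} aligned k≤n ¬split 1≤j j≤n inactive
    | yes j<n | no ¬splitⱼ | no ¬even with blockStart j ≟ blockStart k
  ... | no differ = inj₁ λ t' →
    fromInj₂ (λ same → contradiction same differ) (same-block-or-settled t' k≤n ¬split 1≤j j≤n)
  ... | yes same = inj₂ (begin
    parity (j + k + e + t)                        ≡⟨ parity-+-double (j + k + e + t) (b + w) ⟨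
    parity (j + k + e + t + ((b + w) + (b + w)))  ≡⟨ cong parity (regroup j k e t b w) ⟩
    parity ((j + t + b + w) + (k + e + b + w))    ≡⟨ parity-odd+odd (j + t + b + w) (k + e + b + w) odd aligned ⟩
    0ℙ                                            ∎)
    where
    open ≡-Reasoning
    b = blockStart k
    odd : parity (j + t + b + w) ≡ 1ℙ
    odd = subst (λ b → parity (j + t + b + w) ≡ 1ℙ) same (≢0ℙ⇒≡1ℙ ¬even)
    regroup : ∀ j k e t b w → j + k + e + t + ((b + w) + (b + w)) ≡ (j + t + b + w) + (k + e + b + w)
    regroup = solve-∀

  progress-invariant : ∀ {e k} → Aligned e k → k ≤ n → ¬ Split k →
    (∀ j → j ≤ n → Progress e 0 k j (#below a₀ k j)) →
    ∀ t j → j ≤ n → Progress e t k j (#below (arrangement t) k j)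
  progress-invariant aligned k≤n ¬split initial zero j j≤n = initial j j≤n
  progress-invariant aligned k≤n ¬split initial (suc t) zero _ = inj₁ (inj₁ z≤n)
  progress-invariant {e} {k} aligned k≤n ¬split initial (suc t) (suc i) 1+i≤n = step (active? t (suc i))
    where
    a = arrangement t
    induction = progress-invariant aligned k≤n ¬split initial t

    step : Dec (Active t (suc i)) → Progress e (suc t) k (suc i) (#below (arrangement (suc t)) k (suc i))
    step (yes active) with R.#below-next-active t a k i active
    ... | inj₁ shifted = subst (Progress e (suc t) k (suc i)) (sym shifted)
                           (progress-shift (induction i (<⇒≤ 1+i≤n)))
    ... | inj₂ pulled  = subst (Progress e (suc t) k (suc i)) (sym pulled)
                           (progress-pull (induction (suc (suc i)) (proj₁ active)))
    step (no inactive) = subst (Progress e (suc t) k (suc i)) (sym unchanged)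
      (fromSettledOrEven (inactive-settled-or-even aligned k≤n ¬split (s≤s z≤n) 1+i≤n inactive))
      where
      unchanged : #below (arrangement (suc t)) k (suc i) ≡ #below a k (suc i)
      unchanged = R.#below-next-fixed t a k (suc i) (R.¬active⇒¬swaps t a (suc i) inactive)

      fromSettledOrEven : (∀ t' → Settled k (suc i) (#below (arrangement t') k (suc i))) ⊎
                          parity (suc i + k + e + t) ≡ 0ℙ → Progress e (suc t) k (suc i) (#below a k (suc i))
      fromSettledOrEven (inj₁ settled) = inj₁ (settled t)
      fromSettledOrEven (inj₂ even)    = progress-wait even (induction (suc i) 1+i≤n)

  rounds : ℕ
  rounds = pred (2 * w)

  suc-rounds : suc rounds ≡ 2 * w
  suc-rounds = suc-pred (2 * w) {{>-nonZero (≤-trans 1≤w (m≤m+n w (w + 0)))}}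

  prefix-sorted : ∀ k → k ≤ n → k ≤ #below (arrangement rounds) k k
  prefix-sorted k k≤n with split? k
  ... | yes split = ≤-reflexive (sym (settled-below-split split ≤-refl ≤-refl rounds))
  ... | no ¬split with alignment k
  ...   | inj₁ aligned₁ = reduce (progress-done (≤-reflexive (sym suc-rounds))
            (progress-invariant aligned₁ k≤n ¬split (λ j j≤n → initial-progress₁ k≤n j≤n) rounds k k≤n))
  ...   | inj₂ aligned₂ = reduce (progress-done (≤-trans (≤-reflexive (sym suc-rounds)) (n≤1+n _))
            (progress-invariant aligned₂ k≤n ¬split
              (λ j j≤n → initial-progress₂ k≤n j≤n (aligned₂⇒not-critical k≤n aligned₂)) rounds k k≤n))

  arrangement-sorted : ∀ i → i < n → arrangement rounds i ≡ i
  arrangement-sorted = injective-deflationary⇒id (arrangement-injective rounds) λ i i<n →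
    ≤-pred (count-all⁻ (λ x → arrangement rounds x <? suc i) (suc i) (prefix-sorted (suc i) i<n) i ≤-refl)

  route : ℕ → ℕ → ℕ
  route zero    x = x
  route (suc t) x = layer t (route t x)

  route-range : ∀ t x → x < n → route t x < n
  route-range zero    x x<n = x<n
  route-range (suc t) x x<n = layer-range t (route t x) (route-range t x x<n)

  a₀-route : ∀ t x → a₀ x ≡ arrangement t (route t x)
  a₀-route zero    x = refl
  a₀-route (suc t) x = trans (a₀-route t x) (cong (arrangement t) (sym (R.partner-involutive t _ (route t x))))

  a₀≡route : ∀ x → x < n → a₀ x ≡ route rounds x
  a₀≡route x x<n = trans (a₀-route rounds x) (arrangement-sorted _ (route-range rounds x x<n))

-- Permutation matrices

module _ {n : ℕ} where

  identity-≡ : ∀ {i j : Fin n} → i ≡ j → identity i j ≡ 1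
  identity-≡ {i} {j} i≡j with i Fin.≟ j
  ... | yes _   = refl
  ... | no i≢j = contradiction i≡j i≢j

  identity-≢ : ∀ {i j : Fin n} → i ≢ j → identity i j ≡ 0
  identity-≢ {i} {j} i≢j with i Fin.≟ j
  ... | yes i≡j = contradiction i≡j i≢j
  ... | no _    = refl

  identity-≡1⇒≡ : ∀ {i j : Fin n} → identity i j ≡ 1 → i ≡ j
  identity-≡1⇒≡ {i} {j} e with i Fin.≟ j
  ... | yes i≡j = i≡j

  identity-01 : ∀ (i j : Fin n) → identity i j ≡ 0 ⊎ identity i j ≡ 1
  identity-01 i j with i Fin.≟ j
  ... | yes _ = inj₂ refl
  ... | no  _ = inj₁ refl

identity-suc : ∀ {n} (i j : Fin n) → identity (Fin.suc i) (Fin.suc j) ≡ identity i j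
identity-suc i j = cases (i Fin.≟ j)
  where
  cases : Dec (i ≡ j) → identity (Fin.suc i) (Fin.suc j) ≡ identity i j
  cases (yes i≡j) = trans (identity-≡ (cong Fin.suc i≡j)) (sym (identity-≡ i≡j))
  cases (no i≢j)  = trans (identity-≢ (i≢j ∘ Fin.suc-injective)) (sym (identity-≢ i≢j))

∑-cong : ∀ n {f g : Fin n → ℕ} → (∀ i → f i ≡ g i) → ∑ n f ≡ ∑ n g
∑-cong zero    f≗g = refl
∑-cong (suc n) f≗g = cong₂ _+_ (f≗g Fin.zero) (∑-cong n (f≗g ∘ Fin.suc))

∑-zero : ∀ n → ∑ n (λ _ → 0) ≡ 0
∑-zero zero    = refl
∑-zero (suc n) = ∑-zero n

∑-identity : ∀ n (c : Fin n) (g : Fin n → ℕ) → ∑ n (λ k → identity c k * g k) ≡ g c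
∑-identity (suc n) Fin.zero g =
  trans (cong₂ _+_ (+-identityʳ (g Fin.zero)) rest-zero) (+-identityʳ (g Fin.zero))
  where
  rest-zero : ∑ n (λ k → identity {suc n} Fin.zero (Fin.suc k) * g (Fin.suc k)) ≡ 0
  rest-zero = trans (∑-cong n λ k → cong (_* g (Fin.suc k)) (identity-≢ {i = Fin.zero} {Fin.suc k} λ ()))
                    (∑-zero n)
∑-identity (suc n) (Fin.suc c) g = cong₂ _+_ (cong (_* g Fin.zero) (identity-≢ {i = Fin.suc c} {Fin.zero} λ ()))
  (trans (∑-cong n (λ k → cong (_* g (Fin.suc k)) (identity-suc c k))) (∑-identity n c (g ∘ Fin.suc)))

permMatrix : ∀ {n} → (Fin n → Fin n) → Matrix n
permMatrix f i j = identity (f i) j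

product-permMatrices : ∀ {n} (fs : List (Fin n → Fin n)) (i j : Fin n) →
  product (map permMatrix fs) i j ≡ identity (foldl _|>_ i fs) j
product-permMatrices []       i j = refl
product-permMatrices {n} (f ∷ fs) i j =
  trans (∑-identity n (f i) (λ k → product (map permMatrix fs) k j)) (product-permMatrices fs (f i) j)

permMatrix-isPermutationMatrix : ∀ {n} (f g : Fin n → Fin n) →
  (∀ x → g (f x) ≡ x) → (∀ x → f (g x) ≡ x) → IsPermutationMatrix (permMatrix f)
permMatrix-isPermutationMatrix f g gf fg =
    (λ i j → identity-01 (f i) j)
  , (λ i → f i , identity-≡ refl , λ k e → sym (identity-≡1⇒≡ e))
  , (λ j → g j , identity-≡ (fg j) , λ k e → trans (sym (gf k)) (cong g (identity-≡1⇒≡ e)))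

permMatrix-bandwidth : ∀ {n w} (f : Fin n → Fin n) → (∀ x → dist (toℕ x) (toℕ (f x)) ≤ w) →
  HasBandwidthAtMost w (permMatrix f)
permMatrix-bandwidth f near i j w<dist with f i Fin.≟ j
... | yes refl = contradiction (near i) (<⇒≱ w<dist)
... | no _     = refl

module FromPermutationMatrix {n} (P : Matrix n) (isPerm : IsPermutationMatrix P) where

  private
    zero-one = proj₁ isPerm
    row      = proj₁ (proj₂ isPerm)
    col      = proj₂ (proj₂ isPerm)

  column : Fin n → Fin n
  column i = proj₁ (row i)

  P-column : ∀ i → P i (column i) ≡ 1
  P-column i = proj₁ (proj₂ (row i))

  column-unique : ∀ i j → P i j ≡ 1 → j ≡ column i
  column-unique i = proj₂ (proj₂ (row i))

  row-unique : ∀ j i → P i j ≡ 1 → i ≡ proj₁ (col j)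
  row-unique j = proj₂ (proj₂ (col j))

  P≡permMatrix : ∀ i j → P i j ≡ permMatrix column i j
  P≡permMatrix i j = cases (column i Fin.≟ j) (zero-one i j)
    where
    cases : Dec (column i ≡ j) → P i j ≡ 0 ⊎ P i j ≡ 1 → P i j ≡ identity (column i) j
    cases (yes refl) _        = trans (P-column i) (sym (identity-≡ refl))
    cases (no c≢j) (inj₁ P≡0) = trans P≡0 (sym (identity-≢ c≢j))
    cases (no c≢j) (inj₂ P≡1) = contradiction (sym (column-unique i j P≡1)) c≢j

  column-injective : ∀ i i' → column i ≡ column i' → i ≡ i'
  column-injective i i' c≡c' =
    trans (row-unique (column i) i (P-column i))
          (sym (row-unique (column i) i' (subst (λ c → P i' c ≡ 1) (sym c≡c') (P-column i'))))

  column-near : ∀ {w} → HasBandwidthAtMost w P → ∀ i → dist (toℕ i) (toℕ (column i)) ≤ w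
  column-near {w} band i with w <? dist (toℕ i) (toℕ (column i))
  ... | yes w<dist = contradiction (trans (sym (P-column i)) (band i (column i) w<dist)) λ ()
  ... | no  w≮dist = ≮⇒≥ w≮dist

extend : ∀ {n} → (Fin n → Fin n) → ℕ → ℕ
extend {n} f i with i <? n
... | yes i<n = toℕ (f (fromℕ< i<n))
... | no  _   = i

extend-toℕ : ∀ {n} (f : Fin n → Fin n) x → extend f (toℕ x) ≡ toℕ (f x)
extend-toℕ {n} f x with toℕ x <? n
... | yes x<n = cong (toℕ ∘ f) (Fin.fromℕ<-toℕ x x<n)
... | no  x≮n = contradiction (Fin.toℕ<n x) x≮n

below-elim : ∀ {n} (Q : ℕ → Set) → (∀ (x : Fin n) → Q (toℕ x)) → ∀ i → i < n → Q i
below-elim Q h i i<n = subst Q (Fin.toℕ-fromℕ< i<n) (h (fromℕ< i<n))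

module _ {n} (f : Fin n → Fin n) where

  extend-into : MapsBelow n (extend f)
  extend-into = below-elim (λ i → extend f i < n) λ x →
    subst (_< n) (sym (extend-toℕ f x)) (Fin.toℕ<n (f x))

  extend-injective : (∀ x y → f x ≡ f y → x ≡ y) → InjectiveBelow n (extend f)
  extend-injective f-inj i i' i<n i'<n = injective i i<n i' i'<n
    where
    injective : ∀ i → i < n → ∀ i' → i' < n → extend f i ≡ extend f i' → i ≡ i'
    injective = below-elim (λ i → ∀ i' → i' < n → extend f i ≡ extend f i' → i ≡ i') λ x →
      below-elim (λ i' → extend f (toℕ x) ≡ extend f i' → toℕ x ≡ i') λ y e →
        cong toℕ (f-inj x y (Fin.toℕ-injective (trans (sym (extend-toℕ f x)) (trans e (extend-toℕ f y)))))

  extend-near : ∀ {w} → (∀ x → dist (toℕ x) (toℕ (f x)) ≤ w) → ∀ i → i < n → dist i (extend f i) ≤ w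
  extend-near {w} f-near = below-elim (λ i → dist i (extend f i) ≤ w) λ x →
    subst (λ y → dist (toℕ x) y ≤ w) (sym (extend-toℕ f x)) (f-near x)

module Decomposition {n w} (P : Matrix n) (isPerm : IsPermutationMatrix P)
                     (band : HasBandwidthAtMost w P) (1≤w : 1 ≤ w) where

  open FromPermutationMatrix P isPerm
  open BlockwiseOddEvenSort n w (extend column) (extend-into column)
         (extend-injective column column-injective) (extend-near column (column-near band)) 1≤w

  layerFin : ℕ → Fin n → Fin n
  layerFin t x = fromℕ< (layer-range t (toℕ x) (Fin.toℕ<n x))

  toℕ-layerFin : ∀ t x → toℕ (layerFin t x) ≡ layer t (toℕ x)
  toℕ-layerFin t x = Fin.toℕ-fromℕ< _

  layerFin-involutive : ∀ t x → layerFin t (layerFin t x) ≡ x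
  layerFin-involutive t x = Fin.toℕ-injective (begin
    toℕ (layerFin t (layerFin t x))  ≡⟨ toℕ-layerFin t (layerFin t x) ⟩
    layer t (toℕ (layerFin t x))     ≡⟨ cong (layer t) (toℕ-layerFin t x) ⟩
    layer t (layer t (toℕ x))        ≡⟨ R.partner-involutive t _ (toℕ x) ⟩
    toℕ x                            ∎)
    where open ≡-Reasoning

  layerFin-near : ∀ t x → dist (toℕ x) (toℕ (layerFin t x)) ≤ 1
  layerFin-near t x rewrite toℕ-layerFin t x = R.partner-near t _ (toℕ x)

  layers : ℕ → List (Fin n → Fin n)
  layers zero    = []
  layers (suc t) = layers t ∷ʳ layerFin t

  length-layers : ∀ t → length (layers t) ≡ t
  length-layers zero    = refl
  length-layers (suc t) = trans (length-++ (layers t)) (trans (cong (_+ 1) (length-layers t)) (+-comm t 1))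

  toℕ-apply-layers : ∀ t x → toℕ (foldl _|>_ x (layers t)) ≡ route t (toℕ x)
  toℕ-apply-layers zero    x = refl
  toℕ-apply-layers (suc t) x = begin
    toℕ (foldl _|>_ x (layers t ∷ʳ layerFin t))  ≡⟨ cong toℕ (foldl-∷ʳ _|>_ x (layerFin t) (layers t)) ⟩
    toℕ (layerFin t (foldl _|>_ x (layers t)))   ≡⟨ toℕ-layerFin t _ ⟩
    layer t (toℕ (foldl _|>_ x (layers t)))      ≡⟨ cong (layer t) (toℕ-apply-layers t x) ⟩
    layer t (route t (toℕ x))                    ∎
    where open ≡-Reasoning

  Admissible : Matrix n → Set
  Admissible T = IsPermutationMatrix T × HasBandwidthAtMost 1 T

  layers-admissible : ∀ t → All (Admissible ∘ permMatrix) (layers t)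
  layers-admissible zero    = []
  layers-admissible (suc t) = All.∷ʳ⁺ (layers-admissible t)
    (permMatrix-isPermutationMatrix _ _ (layerFin-involutive t) (layerFin-involutive t) ,
     permMatrix-bandwidth _ (layerFin-near t))

  factors : List (Matrix n)
  factors = map permMatrix (layers rounds)

  factors-admissible : All Admissible factors
  factors-admissible = All.map⁺ (layers-admissible rounds)

  factors-length : length factors < 2 * w
  factors-length = begin-strict
    length factors          ≡⟨ length-map permMatrix (layers rounds) ⟩
    length (layers rounds)  ≡⟨ length-layers rounds ⟩
    rounds                  <⟨ ≤-reflexive suc-rounds ⟩
    2 * w                   ∎
    where open ≤-Reasoning

  factors-product : ∀ i j → product factors i j ≡ P i j
  factors-product i j = begin
    product factors i j                        ≡⟨ product-permMatrices (layers rounds) i j ⟩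
    identity (foldl _|>_ i (layers rounds)) j  ≡⟨ cong (λ c → identity c j) composite≡column ⟩
    identity (column i) j                      ≡⟨ P≡permMatrix i j ⟨
    P i j                                      ∎
    where
    open ≡-Reasoning
    composite≡column : foldl _|>_ i (layers rounds) ≡ column i
    composite≡column = Fin.toℕ-injective (begin
      toℕ (foldl _|>_ i (layers rounds))  ≡⟨ toℕ-apply-layers rounds i ⟩
      route rounds (toℕ i)                ≡⟨ a₀≡route (toℕ i) (Fin.toℕ<n i) ⟨
      extend column (toℕ i)               ≡⟨ extend-toℕ column i ⟩
      toℕ (column i)                      ∎)

theorem4p3 : (n w : ℕ) → (P : Matrix n) → IsPermutationMatrix P → HasBandwidth w P → 1 ≤ w →
    ∃ λ (Ts : List (Matrix n)) →
      (length Ts < 2 * w)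
      × All (λ T → IsPermutationMatrix T × HasBandwidthAtMost 1 T) Ts
      × (∀ (i j : Fin n) → product Ts i j ≡ P i j)
theorem4p3 n w P isPerm (band , _) 1≤w =
  factors , factors-length , factors-admissible , factors-product
  where open Decomposition P isPerm band 1≤w
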